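{- Let $m, n$ be perfect numbers such that $m - n = 3$. Then there exists an integer $p$ such that $2^p - 1$ is prime, $m = 2^{p-1}(2^p-1)$, and $2^p = 5u^2 + 3$ for some integer $u$.
   Context: A positive integer $n$ is perfect if $\sigma(n) = 2n$, where $\sigma(n)$ denotes the sum of all positive divisors of $n$. -}

module Defs where

open import Data.Nat using (ℕ; _*_; _<_)
open import Data.Nat.Divisibility using (_∣?_)
open import Data.List using (filter)
open import Data.List using (List)
open import Data.Nat.ListAction using (sum)
open import Data.List.Base using (upTo; map)
open import Data.Nat using (suc)
open import Relation.Binary.PropositionalEquality using (_≡_)

σ : ℕ → ℕ
σ n = sum (filter (_∣? n) (map suc (upTo n)))

record Perfect (n : ℕ) : Set where
  field
    positive : 0 < n
    sigma≡2n : σ n ≡ 2 * n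

-- Since m − n = 3 is odd, one of m, n is even, hence of Euclid's form 2ᵏ(2ᵏ⁺¹ − 1) with
-- 2ᵏ⁺¹ − 1 prime. Pairing every divisor d of x with x / d shows that σ(x) is divisible by 4
-- when x ≡ 3 (mod 4), and that an odd x with σ(x) odd is a square. If m were odd, n = 2ᵏ(2ᵏ⁺¹ − 1)
-- would give m = 9 (k = 1) or m ≡ 3 (mod 4), contradicting σ(m) = 2m. So m = 2ᵏ(2ᵏ⁺¹ − 1):
-- k = 1 gives n = 3, k = 2 gives 2³ = 5 · 1² + 3, and odd k ≥ 3 makes 3 divide 2ᵏ⁺¹ − 1.
-- For even k ≥ 4, n = A B with A = 2ᵏ⁺¹ − 3 ≡ 5 and B = 2ᵏ + 1 ≡ 1 (mod 8), B is not a square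
-- and gcd(A, B) ∣ 5. Splitting off the powers of 5, σ(n) = 2n with n odd forces one of the
-- 5-free parts of A, B to have odd σ, hence to be a square, and the residues of squares
-- mod 8 leave only A = 5u², that is, 2ᵏ⁺¹ = 5u² + 3.

module Submission where

open import Defs
open import Data.Empty using (⊥-elim)
open import Data.List using (List; []; _∷_; _++_; map; filter; upTo; cartesianProduct)
open import Data.List.Membership.Propositional using (_∈_)
open import Data.List.Membership.Propositional.Properties
open import Data.List.Membership.Propositional.Properties.WithK using (unique∧set⇒bag)
open import Data.List.Properties using (map-++; map-∘)
open import Data.List.Relation.Binary.BagAndSetEquality using (∼bag⇒↭)
import Data.List.Relation.Unary.All as All
open import Data.List.Relation.Unary.All using ([]; _∷_)
open import Data.List.Relation.Unary.AllPairs using ([]; _∷_)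
open import Data.List.Relation.Unary.Any using (here; there)
open import Data.List.Relation.Unary.Unique.Propositional using (Unique)
import Data.List.Relation.Unary.Unique.Propositional.Properties as Unique
open import Data.Nat
open import Data.Nat.Coprimality using (Coprime; coprime-divisor; coprime-/gcd)
import Data.Nat.Coprimality as Coprime
open import Data.Nat.Divisibility
open import Data.Nat.DivMod using (_/_; _%_; m/n*n≡m; m*[n/m]≡n; m*n/n≡m; m%n<n; %-distribˡ-+; %-distribˡ-*; %-remove-+ˡ)
open import Data.Nat.GCD using (gcd; gcd[m,n]∣m; gcd[m,n]∣n)
open import Data.Nat.Induction using (<-rec)
open import Data.Nat.ListAction using (sum)
open import Data.Nat.ListAction.Properties using (sum-++; sum-↭)
open import Data.Nat.Primality
open import Data.Nat.Properties
open import Algebra.Properties.CommutativeSemigroup +-commutativeSemigroup using (interchange)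
open import Data.List.Membership.DecPropositional _≟_ using (_∈?_)
open import Data.Nat.Solver using (module +-*-Solver)
open import Data.Product using (Σ; ∃; ∃₂; _×_; _,_; proj₁; proj₂)
open import Data.Sum as Sum using (_⊎_; inj₁; inj₂; [_,_])
open import Function using (_∘_)
open import Function.Bundles using (mk⇔)
open import Level using (0ℓ)
open import Relation.Binary.PropositionalEquality hiding ([_])
open import Relation.Nullary using (¬_; Dec; yes; no)
open import Relation.Nullary.Decidable using (from-yes)
open import Relation.Unary using (Pred; Decidable)
open import Relation.Unary.Properties using (∁?)
open +-*-Solver

private variable
  a b d e h m n p s w x y z P : ℕ
  xs ys : List ℕ

m*n>0 : 0 < a → 0 < b → 0 < a * b
m*n>0 {suc a} {suc b} _ _ = z<s

m*n>0⇒m>0 : 0 < a * b → 0 < a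
m*n>0⇒m>0 {suc a} _ = z<s

m*n>0⇒n>0 : ∀ a → 0 < a * b → 0 < b
m*n>0⇒n>0 {b} a ab>0 = m*n>0⇒m>0 (subst (0 <_) (*-comm a b) ab>0)

sum-unique-≡ : Unique xs → Unique ys →
  (∀ {z} → z ∈ xs → z ∈ ys) → (∀ {z} → z ∈ ys → z ∈ xs) → sum xs ≡ sum ys
sum-unique-≡ ux uy xs⊆ys ys⊆xs = sum-↭ (∼bag⇒↭ (unique∧set⇒bag ux uy (mk⇔ xs⊆ys ys⊆xs)))

sum-partition : ∀ {P : Pred ℕ 0ℓ} (P? : Decidable P) xs →
  sum xs ≡ sum (filter P? xs) + sum (filter (∁? P?) xs)
sum-partition P? [] = refl
sum-partition P? (x ∷ xs) with P? x
... | yes _ = trans (cong (x +_) (sum-partition P? xs)) (sym (+-assoc x _ _))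
... | no _ = trans (cong (x +_) (sum-partition P? xs)) (x+[y+z]≡y+[x+z] x (sum (filter P? xs)) _)
  where
  x+[y+z]≡y+[x+z] : ∀ x y z → x + (y + z) ≡ y + (x + z)
  x+[y+z]≡y+[x+z] x y z = trans (sym (+-assoc x y z)) (trans (cong (_+ z) (+-comm x y)) (+-assoc y x z))

sum-filter-≤ : ∀ {P : Pred ℕ 0ℓ} (P? : Decidable P) xs → sum (filter P? xs) ≤ sum xs
sum-filter-≤ P? xs = subst (sum (filter P? xs) ≤_) (sym (sum-partition P? xs)) (m≤m+n _ _)

sum-map-+ : ∀ (g : ℕ → ℕ) xs → sum (map (λ x → x + g x) xs) ≡ sum xs + sum (map g xs)
sum-map-+ g [] = refl
sum-map-+ g (x ∷ xs) =
  trans (cong (x + g x +_) (sum-map-+ g xs)) (interchange x (g x) _ _)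

sum-map-* : ∀ c xs → sum (map (c *_) xs) ≡ c * sum xs
sum-map-* c [] = sym (*-zeroʳ c)
sum-map-* c (x ∷ xs) = trans (cong (c * x +_) (sum-map-* c xs)) (sym (*-distribˡ-+ c x (sum xs)))

sum-cartesianProduct-* : ∀ xs ys →
  sum (map (λ (x , y) → x * y) (cartesianProduct xs ys)) ≡ sum xs * sum ys
sum-cartesianProduct-* [] ys = refl
sum-cartesianProduct-* (x ∷ xs) ys = begin
    sum (map mul (map (x ,_) ys ++ cartesianProduct xs ys))
  ≡⟨ cong sum (map-++ mul (map (x ,_) ys) (cartesianProduct xs ys)) ⟩
    sum (map mul (map (x ,_) ys) ++ map mul (cartesianProduct xs ys))
  ≡⟨ sum-++ (map mul (map (x ,_) ys)) _ ⟩
    sum (map mul (map (x ,_) ys)) + sum (map mul (cartesianProduct xs ys))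
  ≡⟨ cong (λ l → sum l + sum (map mul (cartesianProduct xs ys))) (sym (map-∘ ys)) ⟩
    sum (map (x *_) ys) + sum (map mul (cartesianProduct xs ys))
  ≡⟨ cong₂ _+_ (sum-map-* x ys) (sum-cartesianProduct-* xs ys) ⟩
    x * sum ys + sum xs * sum ys
  ≡⟨ sym (*-distribʳ-+ (sum ys) x (sum xs)) ⟩
    (x + sum xs) * sum ys ∎
  where
  open ≡-Reasoning
  mul : ℕ × ℕ → ℕ
  mul (x , y) = x * y

unique-map⁺ : ∀ {A : Set} {f : A → ℕ} {xs : List A} → Unique xs →
  (∀ {u v} → u ∈ xs → v ∈ xs → f u ≡ f v → u ≡ v) → Unique (map f xs)
unique-map⁺ {xs = []} [] injective = []
unique-map⁺ {f = f} {xs = x ∷ xs} (x∉xs ∷ uxs) injective =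
  All.tabulate (λ fy∈ fx≡fy → let (y , y∈xs , fy≡) = ∈-map⁻ f fy∈ in
    All.lookup x∉xs y∈xs (injective (here refl) (there y∈xs) (trans fx≡fy fy≡)))
  ∷ unique-map⁺ uxs (λ u∈ v∈ → injective (there u∈) (there v∈))

-- Divisors and the multiplicativity of σ

divisors : ℕ → List ℕ
divisors n = filter (_∣? n) (map suc (upTo n))

divisors-unique : ∀ n → Unique (divisors n)
divisors-unique n = Unique.filter⁺ (_∣? n) (Unique.map⁺ suc-injective (Unique.upTo⁺ n))

∈divisors⇒∣ : ∀ n → d ∈ divisors n → d ∣ n
∈divisors⇒∣ n d∈ = proj₂ (∈-filter⁻ (_∣? n) {xs = map suc (upTo n)} d∈)

∈divisors⇒>0 : ∀ n → d ∈ divisors n → 0 < d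
∈divisors⇒>0 n d∈ with ∈-map⁻ suc (proj₁ (∈-filter⁻ (_∣? n) {xs = map suc (upTo n)} d∈))
... | _ , _ , refl = s≤s z≤n

∣⇒∈divisors : 0 < n → d ∣ n → d ∈ divisors n
∣⇒∈divisors {suc n} {zero} _ 0∣n = ⊥-elim (1+n≢0 (0∣⇒≡0 0∣n))
∣⇒∈divisors {suc n} {suc d} _ d∣n = ∈-filter⁺ (_∣? suc n) (∈-map⁺ suc (∈-upTo⁺ (∣⇒≤ d∣n))) d∣n

σ≡sum : ∀ {L} → 0 < n → Unique L → (∀ {z} → z ∈ L → z ∣ n) → (∀ {z} → z ∣ n → z ∈ L) → σ n ≡ sum L
σ≡sum {n} n>0 uL L∣n ∣n⇒∈L =
  sum-unique-≡ (divisors-unique n) uL (λ z∈ → ∣n⇒∈L (∈divisors⇒∣ n z∈)) (λ z∈ → ∣⇒∈divisors n>0 (L∣n z∈))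

sum≤σ : ∀ {L} → 0 < n → Unique L → (∀ {z} → z ∈ L → z ∣ n) → sum L ≤ σ n
sum≤σ {n} {L} n>0 uL L∣n = begin
  sum L                          ≡⟨ sum-unique-≡ uL (Unique.filter⁺ (_∈? L) (divisors-unique n)) L⊆ ⊆L ⟩
  sum (filter (_∈? L) (divisors n)) ≤⟨ sum-filter-≤ (_∈? L) (divisors n) ⟩
  σ n                            ∎
  where
  open ≤-Reasoning
  L⊆ : ∀ {z} → z ∈ L → z ∈ filter (_∈? L) (divisors n)
  L⊆ z∈L = ∈-filter⁺ (_∈? L) (∣⇒∈divisors n>0 (L∣n z∈L)) z∈L
  ⊆L : ∀ {z} → z ∈ filter (_∈? L) (divisors n) → z ∈ L
  ⊆L z∈ = proj₂ (∈-filter⁻ (_∈? L) {xs = divisors n} z∈)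

coprime-∣ : Coprime a b → d ∣ a → e ∣ b → Coprime d e
coprime-∣ coprime d∣a e∣b (c∣d , c∣e) = coprime (∣-trans c∣d d∣a , ∣-trans c∣e e∣b)

∣*⇒∃factors : ∀ {a b c} → .{{_ : NonZero a}} → c ∣ a * b → ∃₂ λ d e → d ∣ a × e ∣ b × c ≡ d * e
∣*⇒∃factors {a} {b} {c} c∣ab =
  g , c / g , gcd[m,n]∣n c a , c/g∣b , sym (m*[n/m]≡n (gcd[m,n]∣m c a))
  where
  g = gcd c a
  instance
    g≢0 : NonZero g
    g≢0 = ≢-nonZero λ g≡0 → ≢-nonZero⁻¹ a (0∣⇒≡0 (subst (_∣ a) g≡0 (gcd[m,n]∣n c a)))
  ab≡a/g*b*g : a * b ≡ a / g * b * g
  ab≡a/g*b*g = begin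
    a * b           ≡⟨ cong (_* b) (sym (m/n*n≡m (gcd[m,n]∣n c a))) ⟩
    a / g * g * b   ≡⟨ *-assoc (a / g) g b ⟩
    a / g * (g * b) ≡⟨ cong (a / g *_) (*-comm g b) ⟩
    a / g * (b * g) ≡⟨ sym (*-assoc (a / g) b g) ⟩
    a / g * b * g   ∎
    where open ≡-Reasoning
  c/g∣b : c / g ∣ b
  c/g∣b = coprime-divisor (coprime-/gcd c a)
    (*-cancelʳ-∣ g (subst₂ _∣_ (sym (m/n*n≡m (gcd[m,n]∣m c a))) ab≡a/g*b*g c∣ab))

σ-multiplicative : 0 < a → 0 < b → Coprime a b → σ (a * b) ≡ σ a * σ b
σ-multiplicative {a} {b} a>0 b>0 coprime = begin
  σ (a * b)   ≡⟨ σ≡sum (m*n>0 a>0 b>0) (unique-map⁺ unique-pairs mul-injective) L∣ab ∣ab⇒∈L ⟩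
  sum L       ≡⟨ sum-cartesianProduct-* (divisors a) (divisors b) ⟩
  σ a * σ b   ∎
  where
  open ≡-Reasoning
  instance
    a≢0 : NonZero a
    a≢0 = >-nonZero a>0
  mul : ℕ × ℕ → ℕ
  mul (d , e) = d * e
  pairs = cartesianProduct (divisors a) (divisors b)
  L = map mul pairs
  unique-pairs : Unique pairs
  unique-pairs = Unique.cartesianProduct⁺ (divisors-unique a) (divisors-unique b)
  mul-injective : ∀ {u v} → u ∈ pairs → v ∈ pairs → mul u ≡ mul v → u ≡ v
  mul-injective {d₁ , e₁} {d₂ , e₂} u∈ v∈ d₁e₁≡d₂e₂
    with d₁∈ , e₁∈ ← ∈-cartesianProduct⁻ (divisors a) (divisors b) u∈
       | d₂∈ , e₂∈ ← ∈-cartesianProduct⁻ (divisors a) (divisors b) v∈ = cong₂ _,_ d₁≡d₂ e₁≡e₂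
    where
    d₁∣d₂ : d₁ ∣ d₂
    d₁∣d₂ = coprime-divisor (coprime-∣ coprime (∈divisors⇒∣ a d₁∈) (∈divisors⇒∣ b e₂∈))
      (divides e₁ (trans (*-comm e₂ d₂) (trans (sym d₁e₁≡d₂e₂) (*-comm d₁ e₁))))
    d₂∣d₁ : d₂ ∣ d₁
    d₂∣d₁ = coprime-divisor (coprime-∣ coprime (∈divisors⇒∣ a d₂∈) (∈divisors⇒∣ b e₁∈))
      (divides e₂ (trans (*-comm e₁ d₁) (trans d₁e₁≡d₂e₂ (*-comm d₂ e₂))))
    d₁≡d₂ : d₁ ≡ d₂
    d₁≡d₂ = ∣-antisym d₁∣d₂ d₂∣d₁
    e₁≡e₂ : e₁ ≡ e₂
    e₁≡e₂ = *-cancelˡ-≡ e₁ e₂ d₁ {{>-nonZero (∈divisors⇒>0 a d₁∈)}} (trans d₁e₁≡d₂e₂ (cong (_* e₂) (sym d₁≡d₂)))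
  L∣ab : ∀ {z} → z ∈ L → z ∣ a * b
  L∣ab z∈ with (d , e) , de∈ , refl ← ∈-map⁻ mul z∈
    with d∈ , e∈ ← ∈-cartesianProduct⁻ (divisors a) (divisors b) de∈ =
    *-pres-∣ (∈divisors⇒∣ a d∈) (∈divisors⇒∣ b e∈)
  ∣ab⇒∈L : ∀ {z} → z ∣ a * b → z ∈ L
  ∣ab⇒∈L z∣ab with d , e , d∣a , e∣b , refl ← ∣*⇒∃factors {a = a} {b = b} z∣ab =
    ∈-map⁺ mul {xs = pairs} (∈-cartesianProduct⁺ (∣⇒∈divisors a>0 d∣a) (∣⇒∈divisors b>0 e∣b))

prime∤⇒coprime : Prime p → ¬ p ∣ y → Coprime p y
prime∤⇒coprime p-prime p∤y (d∣p , d∣y) with prime⇒irreducible p-prime d∣p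
... | inj₁ d≡1 = d≡1
... | inj₂ refl = ⊥-elim (p∤y d∣y)

powers : ℕ → ℕ → List ℕ
powers p zero = 1 ∷ []
powers p (suc k) = 1 ∷ map (p *_) (powers p k)

∈powers⇒∣ : ∀ p k → z ∈ powers p k → z ∣ p ^ k
∈powers⇒∣ p zero (here refl) = ∣-refl
∈powers⇒∣ p (suc k) (here refl) = 1∣ _
∈powers⇒∣ p (suc k) (there z∈) with y , y∈ , refl ← ∈-map⁻ (p *_) z∈ = *-monoʳ-∣ p (∈powers⇒∣ p k y∈)

∈powers⇒≡1⊎p∣ : ∀ p k → z ∈ powers p k → z ≡ 1 ⊎ p ∣ z
∈powers⇒≡1⊎p∣ p zero (here refl) = inj₁ refl
∈powers⇒≡1⊎p∣ p (suc k) (here refl) = inj₁ refl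
∈powers⇒≡1⊎p∣ p (suc k) (there z∈) with y , _ , refl ← ∈-map⁻ (p *_) z∈ = inj₂ (m∣m*n y)

∣p^k⇒∈powers : Prime p → ∀ k → z ∣ p ^ k → z ∈ powers p k
∣p^k⇒∈powers _ zero z∣1 = here (∣1⇒≡1 z∣1)
∣p^k⇒∈powers {p} {z} p-prime (suc k) z∣p^[1+k] with p ∣? z
... | yes (divides y refl) = there (subst (_∈ map (p *_) (powers p k)) (*-comm p y)
        (∈-map⁺ (p *_) (∣p^k⇒∈powers p-prime k (*-cancelʳ-∣ p {{prime⇒nonZero p-prime}} y*p∣p^k*p))))
  where
  y*p∣p^k*p : y * p ∣ p ^ k * p
  y*p∣p^k*p = subst (y * p ∣_) (*-comm p (p ^ k)) z∣p^[1+k]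
... | no p∤z with ∣p^k⇒∈powers p-prime k (coprime-divisor (Coprime.sym (prime∤⇒coprime p-prime p∤z)) z∣p^[1+k])
...   | z∈ with ∈powers⇒≡1⊎p∣ p k z∈
...     | inj₁ z≡1 = here z≡1
...     | inj₂ p∣z = ⊥-elim (p∤z p∣z)

powers-unique : 1 < p → ∀ k → Unique (powers p k)
powers-unique p>1 zero = [] ∷ []
powers-unique {p} p>1 (suc k) =
  All.tabulate (λ z∈ 1≡z → 1∉ (subst (_∈ map (p *_) (powers p k)) (sym 1≡z) z∈))
  ∷ Unique.map⁺ (*-cancelˡ-≡ _ _ p {{>-nonZero (<-trans z<s p>1)}}) (powers-unique p>1 k)
  where
  1∉ : ¬ 1 ∈ map (p *_) (powers p k)
  1∉ 1∈ with y , _ , 1≡py ← ∈-map⁻ (p *_) 1∈ = >⇒≢ p>1 (∣1⇒≡1 (divides y (trans 1≡py (*-comm p y))))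

σ[p^k]≡sum-powers : Prime p → ∀ k → σ (p ^ k) ≡ sum (powers p k)
σ[p^k]≡sum-powers {p} p-prime k =
  σ≡sum (m^n>0 p {{prime⇒nonZero p-prime}} k) (powers-unique (nonTrivial⇒n>1 p {{prime⇒nonTrivial p-prime}}) k) (∈powers⇒∣ p k) (∣p^k⇒∈powers p-prime k)

1+σ[2^k]≡2^[1+k] : ∀ k → 1 + σ (2 ^ k) ≡ 2 ^ suc k
1+σ[2^k]≡2^[1+k] k = trans (cong suc (σ[p^k]≡sum-powers prime[2] k)) (1+sum-powers-2 k)
  where
  1+sum-powers-2 : ∀ k → 1 + sum (powers 2 k) ≡ 2 ^ suc k
  1+sum-powers-2 zero = refl
  1+sum-powers-2 (suc k) = begin
    2 + sum (map (2 *_) (powers 2 k)) ≡⟨ cong (2 +_) (sum-map-* 2 (powers 2 k)) ⟩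
    2 + 2 * sum (powers 2 k)          ≡⟨ sym (*-distribˡ-+ 2 1 (sum (powers 2 k))) ⟩
    2 * (1 + sum (powers 2 k))        ≡⟨ cong (2 *_) (1+sum-powers-2 k) ⟩
    2 ^ suc (suc k)                   ∎
    where open ≡-Reasoning

coprime-^ : Prime p → ¬ p ∣ y → ∀ k → Coprime (p ^ k) y
coprime-^ {p} p-prime p∤y k (d∣p^k , d∣y) with ∈powers⇒≡1⊎p∣ p k (∣p^k⇒∈powers p-prime k d∣p^k)
... | inj₁ d≡1 = d≡1
... | inj₂ p∣d = ⊥-elim (p∤y (∣-trans p∣d d∣y))

-- Pairing a divisor d with x / d

cofactor : ℕ → ℕ → ℕ
cofactor x zero = 0
cofactor x (suc d) = x / suc d

*-cofactor : ∀ {d} → d ∣ x → d * cofactor x d ≡ x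
*-cofactor {d = zero} 0∣x = sym (0∣⇒≡0 0∣x)
*-cofactor {d = suc d} d∣x = m*[n/m]≡n d∣x

cofactor-unique : ∀ {d e} → 0 < d → d * e ≡ x → cofactor x d ≡ e
cofactor-unique {d = suc d} {e} _ refl = trans (cong (_/ suc d) (*-comm (suc d) e)) (m*n/n≡m e (suc d))

cofactor-∣ : ∀ {d} → d ∣ x → cofactor x d ∣ x
cofactor-∣ {d = d} d∣x = divides d (sym (*-cofactor d∣x))

∣-sum-map : ∀ {c} (f : ℕ → ℕ) xs → (∀ {d} → d ∈ xs → c ∣ f d) → c ∣ sum (map f xs)
∣-sum-map f [] _ = divides 0 refl
∣-sum-map f (d ∷ xs) c∣f = ∣m∣n⇒∣m+n (c∣f (here refl)) (∣-sum-map f xs (c∣f ∘ there))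

-- A divisor d with d² < x is paired with x / d; what remains are the square roots of x.
square⊎σ-paired : 0 < x →
  (∃ λ s → s * s ≡ x) ⊎ (∀ {c} → (∀ d e → d * e ≡ x → c ∣ d + e) → c ∣ σ x)
square⊎σ-paired {x} x>0 = decide roots (λ s∈ → proj₂ (∈-filter⁻ root? {xs = rest} s∈)) σ≡paired+roots
  where
  small? = λ d → d * d <? x
  root? = λ d → d * d ≟ x
  D = divisors x
  small = filter small? D
  rest = filter (∁? small?) D
  roots = filter root? rest
  large = filter (∁? root?) rest

  ∈small⇒∣ : ∀ {d} → d ∈ small → d ∣ x
  ∈small⇒∣ d∈ = ∈divisors⇒∣ x (proj₁ (∈-filter⁻ small? {xs = D} d∈))

  cofactor-injective : ∀ {u v} → u ∈ small → v ∈ small → cofactor x u ≡ cofactor x v → u ≡ v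
  cofactor-injective {u} {v} u∈ v∈ cu≡cv = *-cancelʳ-≡ u v (cofactor x u) {{>-nonZero cu>0}}
    (trans (*-cofactor (∈small⇒∣ u∈)) (trans (sym (*-cofactor (∈small⇒∣ v∈))) (cong (v *_) (sym cu≡cv))))
    where
    cu>0 : 0 < cofactor x u
    cu>0 = m*n>0⇒n>0 u (subst (0 <_) (sym (*-cofactor (∈small⇒∣ u∈))) x>0)

  cofactor∈large : ∀ {d} → d ∈ small → cofactor x d ∈ large
  cofactor∈large {d} d∈ =
    ∈-filter⁺ (∁? root?) {xs = rest}
      (∈-filter⁺ (∁? small?) {xs = D} (∣⇒∈divisors x>0 (cofactor-∣ d∣x)) (<⇒≱ x<e′*e′ ∘ <⇒≤))
      (λ e′*e′≡x → <-irrefl (sym e′*e′≡x) x<e′*e′)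
    where
    d∣x : d ∣ x
    d∣x = ∈small⇒∣ d∈
    e′ = cofactor x d
    d*e′≡x : d * e′ ≡ x
    d*e′≡x = *-cofactor d∣x
    e′>0 : 0 < e′
    e′>0 = m*n>0⇒n>0 d (subst (0 <_) (sym d*e′≡x) x>0)
    d<e′ : d < e′
    d<e′ = *-cancelˡ-< d d e′ (subst (d * d <_) (sym d*e′≡x) (proj₂ (∈-filter⁻ small? {xs = D} d∈)))
    x<e′*e′ : x < e′ * e′
    x<e′*e′ = subst (_< e′ * e′) d*e′≡x (*-monoˡ-< e′ {{>-nonZero e′>0}} d<e′)

  ∈large⇒cofactor : ∀ {e} → e ∈ large → e ∈ map (cofactor x) small
  ∈large⇒cofactor {e} e∈ with e∈rest , e*e≢x ← ∈-filter⁻ (∁? root?) {xs = rest} e∈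
    with e∈D , e*e≮x ← ∈-filter⁻ (∁? small?) {xs = D} e∈rest =
    subst (_∈ map (cofactor x) small) (cofactor-unique d′>0 d′*e≡x) (∈-map⁺ (cofactor x) d′∈small)
    where
    e∣x : e ∣ x
    e∣x = ∈divisors⇒∣ x e∈D
    d′ = cofactor x e
    e*d′≡x : e * d′ ≡ x
    e*d′≡x = *-cofactor e∣x
    d′*e≡x : d′ * e ≡ x
    d′*e≡x = trans (*-comm d′ e) e*d′≡x
    x<e*e : x < e * e
    x<e*e = ≤∧≢⇒< (≮⇒≥ e*e≮x) (e*e≢x ∘ sym)
    d′>0 : 0 < d′
    d′>0 = m*n>0⇒m>0 (subst (0 <_) (sym d′*e≡x) x>0)
    d′<e : d′ < e
    d′<e = ≰⇒> (λ e≤d′ → <⇒≱ x<e*e (subst (e * e ≤_) e*d′≡x (*-monoʳ-≤ e e≤d′)))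
    d′∈small : d′ ∈ small
    d′∈small = ∈-filter⁺ small? {xs = D} (∣⇒∈divisors x>0 (cofactor-∣ e∣x))
      (subst (d′ * d′ <_) d′*e≡x (*-monoʳ-< d′ {{>-nonZero d′>0}} d′<e))

  σ≡paired+roots : σ x ≡ sum (map (λ d → d + cofactor x d) small) + sum roots
  σ≡paired+roots = begin
    sum D                                                  ≡⟨ sum-partition small? D ⟩
    sum small + sum rest                                   ≡⟨ cong (sum small +_) (sum-partition root? rest) ⟩
    sum small + (sum roots + sum large)                    ≡⟨ cong (λ t → sum small + (sum roots + t)) large≡ ⟩
    sum small + (sum roots + sum (map (cofactor x) small)) ≡⟨ cong (sum small +_) (+-comm (sum roots) _) ⟩
    sum small + (sum (map (cofactor x) small) + sum roots) ≡⟨ sym (+-assoc (sum small) _ _) ⟩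
    sum small + sum (map (cofactor x) small) + sum roots   ≡⟨ cong (_+ sum roots) (sym (sum-map-+ (cofactor x) small)) ⟩
    sum (map (λ d → d + cofactor x d) small) + sum roots   ∎
    where
    open ≡-Reasoning
    large≡ : sum large ≡ sum (map (cofactor x) small)
    large≡ = sum-unique-≡ (Unique.filter⁺ (∁? root?) (Unique.filter⁺ (∁? small?) (divisors-unique x)))
      (unique-map⁺ (Unique.filter⁺ small? (divisors-unique x)) cofactor-injective)
      ∈large⇒cofactor
      (λ e∈ → let d , d∈ , e≡ = ∈-map⁻ (cofactor x) e∈ in subst (_∈ large) (sym e≡) (cofactor∈large d∈))

  decide : ∀ rs → (∀ {s} → s ∈ rs → s * s ≡ x) →
    σ x ≡ sum (map (λ d → d + cofactor x d) small) + sum rs →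
    (∃ λ s → s * s ≡ x) ⊎ (∀ {c} → (∀ d e → d * e ≡ x → c ∣ d + e) → c ∣ σ x)
  decide (s ∷ _) s∈⇒ _ = inj₁ (s , s∈⇒ (here refl))
  decide [] _ σ≡ = inj₂ λ {c} c∣pair → subst (c ∣_) (sym (trans σ≡ (+-identityʳ _)))
    (∣-sum-map _ small (λ {d} d∈ → c∣pair d (cofactor x d) (*-cofactor (∈small⇒∣ d∈))))

2∤1 : ¬ 2 ∣ 1
2∤1 2∣1 with () ← ∣1⇒≡1 2∣1

odd⇒%2≡1 : ¬ 2 ∣ a → a % 2 ≡ 1
odd⇒%2≡1 {a} 2∤a with a % 2 | m%n<n a 2 | m%n≡0⇒n∣m a 2
... | 0 | _ | 2∣a = ⊥-elim (2∤a (2∣a refl))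
... | 1 | _ | _ = refl
... | suc (suc _) | s≤s (s≤s ()) | _

odd+odd⇒even : ¬ 2 ∣ a → ¬ 2 ∣ b → 2 ∣ a + b
odd+odd⇒even {a} {b} 2∤a 2∤b = m%n≡0⇒n∣m (a + b) 2
  (trans (%-distribˡ-+ a b 2) (cong₂ (λ r s → (r + s) % 2) (odd⇒%2≡1 2∤a) (odd⇒%2≡1 2∤b)))

∣odd⇒odd : d ∣ x → ¬ 2 ∣ x → ¬ 2 ∣ d
∣odd⇒odd d∣x 2∤x 2∣d = 2∤x (∣-trans 2∣d d∣x)

-- (d + 1)(e + 1) = (de + 1) + (d + e), and both factors on the left are even.
4∣de+1⇒4∣d+e : ¬ 2 ∣ d → ¬ 2 ∣ e → 4 ∣ d * e + 1 → 4 ∣ d + e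
4∣de+1⇒4∣d+e {d} {e} 2∤d 2∤e 4∣de+1 = ∣m+n∣m⇒∣n (subst (4 ∣_) expand 4∣[d+1][e+1]) 4∣de+1
  where
  4∣[d+1][e+1] : 4 ∣ (d + 1) * (e + 1)
  4∣[d+1][e+1] = *-pres-∣ (odd+odd⇒even 2∤d 2∤1) (odd+odd⇒even 2∤e 2∤1)
  expand : (d + 1) * (e + 1) ≡ d * e + 1 + (d + e)
  expand = solve 2 (λ d e → (d :+ con 1) :* (e :+ con 1) := d :* e :+ con 1 :+ (d :+ e)) refl d e

odd*odd⁻¹ : ¬ 2 ∣ d * e → ¬ 2 ∣ d × ¬ 2 ∣ e
odd*odd⁻¹ {d} {e} 2∤de = (λ 2∣d → 2∤de (∣m⇒∣m*n e 2∣d)) , (λ 2∣e → 2∤de (∣n⇒∣m*n d 2∣e))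

odd∧σ-odd⇒square : 0 < x → ¬ 2 ∣ x → ¬ 2 ∣ σ x → ∃ λ s → s * s ≡ x
odd∧σ-odd⇒square {x} x>0 2∤x 2∤σx with square⊎σ-paired x>0
... | inj₁ square = square
... | inj₂ paired = ⊥-elim (2∤σx (paired λ d e de≡x →
  let 2∤d , 2∤e = odd*odd⁻¹ {d} {e} (subst (λ y → ¬ 2 ∣ y) (sym de≡x) 2∤x) in odd+odd⇒even 2∤d 2∤e))

4∣x+1⇒odd : 4 ∣ x + 1 → ¬ 2 ∣ x
4∣x+1⇒odd 4∣x+1 2∣x = 2∤1 (∣m+n∣m⇒∣n (∣-trans (divides 2 refl) 4∣x+1) 2∣x)

4∣x+1⇒4∣σ : 0 < x → 4 ∣ x + 1 → 4 ∣ σ x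
4∣x+1⇒4∣σ {x} x>0 4∣x+1 with square⊎σ-paired x>0
... | inj₁ (s , refl) = ⊥-elim (2∤s (*-cancelˡ-∣ 2 (subst (4 ∣_) s+s≡2s (4∣de+1⇒4∣d+e 2∤s 2∤s 4∣x+1))))
  where
  2∤s : ¬ 2 ∣ s
  2∤s = proj₁ (odd*odd⁻¹ (4∣x+1⇒odd 4∣x+1))
  s+s≡2s : s + s ≡ 2 * s
  s+s≡2s = cong (s +_) (sym (+-identityʳ s))
... | inj₂ paired = paired λ d e de≡x →
  let 2∤d , 2∤e = odd*odd⁻¹ {d} {e} (subst (λ y → ¬ 2 ∣ y) (sym de≡x) (4∣x+1⇒odd 4∣x+1))
  in 4∣de+1⇒4∣d+e 2∤d 2∤e (subst (λ y → 4 ∣ y + 1) (sym de≡x) 4∣x+1)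

perfect∧odd⇒4∤σ : Perfect x → ¬ 2 ∣ x → ¬ 4 ∣ σ x
perfect∧odd⇒4∤σ {x} perfect 2∤x 4∣σx =
  2∤x (*-cancelˡ-∣ 2 (subst (4 ∣_) (Perfect.sigma≡2n perfect) 4∣σx))

-- Even perfect numbers

p-adic-split : 1 < p → ∀ m → 0 < m → ∃₂ λ k b → m ≡ p ^ k * b × ¬ p ∣ b
p-adic-split {p} p>1 = <-rec _ split
  where
  split : ∀ m → (∀ {q} → q < m → 0 < q → ∃₂ λ k b → q ≡ p ^ k * b × ¬ p ∣ b) →
    0 < m → ∃₂ λ k b → m ≡ p ^ k * b × ¬ p ∣ b
  split m rec m>0 with p ∣? m
  ... | no p∤m = 0 , m , sym (+-identityʳ m) , p∤m
  ... | yes (divides q refl)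
    with k , b , q≡ , p∤b ← rec (m<m*n q p {{>-nonZero (m*n>0⇒m>0 m>0)}} p>1) (m*n>0⇒m>0 m>0) =
    suc k , b , q*p≡ , p∤b
    where
    q*p≡ : q * p ≡ p ^ suc k * b
    q*p≡ = begin
      q * p             ≡⟨ cong (_* p) q≡ ⟩
      p ^ k * b * p     ≡⟨ *-comm (p ^ k * b) p ⟩
      p * (p ^ k * b)   ≡⟨ sym (*-assoc p (p ^ k) b) ⟩
      p ^ suc k * b     ∎
      where open ≡-Reasoning

1+d+n≤σ : 0 < n → d ∣ n → d ≢ 1 → d ≢ n → 1 + d + n ≤ σ n
1+d+n≤σ {n} {d} n>0 d∣n d≢1 d≢n = subst (_≤ σ n) sum≡ (sum≤σ n>0 unique divides-n)
  where
  1≢n : 1 ≢ n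
  1≢n refl = d≢1 (∣1⇒≡1 d∣n)
  unique : Unique (1 ∷ d ∷ n ∷ [])
  unique = ((λ 1≡d → d≢1 (sym 1≡d)) ∷ 1≢n ∷ []) ∷ (d≢n ∷ []) ∷ [] ∷ []
  divides-n : ∀ {z} → z ∈ 1 ∷ d ∷ n ∷ [] → z ∣ n
  divides-n (here refl) = 1∣ n
  divides-n (there (here refl)) = d∣n
  divides-n (there (there (here refl))) = ∣-refl
  sum≡ : 1 + (d + (n + 0)) ≡ 1 + d + n
  sum≡ = cong (λ t → 1 + (d + t)) (+-identityʳ n)

σ≡1+n⇒prime : 1 < n → σ n ≡ 1 + n → Prime n
σ≡1+n⇒prime {n} n>1 σn≡1+n = irreducible⇒prime {{n>1⇒nonTrivial n>1}} irreducible
  where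
  irreducible : Irreducible n
  irreducible {d} d∣n with d ≟ 1 | d ≟ n
  ... | yes d≡1 | _ = inj₁ d≡1
  ... | no _ | yes d≡n = inj₂ d≡n
  ... | no d≢1 | no d≢n = ⊥-elim (d≢0 (n≤0⇒n≡0 (+-cancelʳ-≤ n d 0 (+-cancelˡ-≤ 1 (d + n) n
          (subst (1 + d + n ≤_) σn≡1+n (1+d+n≤σ (<-trans z<s n>1) d∣n d≢1 d≢n))))))
    where
    d≢0 : d ≢ 0
    d≢0 refl = >⇒≢ (<-trans z<s n>1) (0∣⇒≡0 d∣n)

-- Euclid's argument: M is coprime to M + 1, so M ∣ b, and then σ b = b + b / M forces b / M = 1.
M*σb≡[1+M]*b⇒b≡M : ∀ {M} → 1 < M → 0 < b → M * σ b ≡ suc M * b → b ≡ M × σ b ≡ 1 + b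
M*σb≡[1+M]*b⇒b≡M {b} {M} M>1 b>0 eq = b≡M , trans σb≡c+b (cong (_+ b) c≡1)
  where
  instance
    M≢0 : NonZero M
    M≢0 = >-nonZero (<-trans z<s M>1)
  M∣b : M ∣ b
  M∣b = coprime-divisor coprime (divides (σ b) (trans (sym eq) (*-comm M (σ b))))
    where
    coprime : Coprime M (suc M)
    coprime {d} (d∣M , d∣1+M) = ∣1⇒≡1 (∣m+n∣m⇒∣n (subst (d ∣_) (+-comm 1 M) d∣1+M) d∣M)
  c = _∣_.quotient M∣b
  b≡cM : b ≡ c * M
  b≡cM = _∣_.equality M∣b
  σb≡c+b : σ b ≡ c + b
  σb≡c+b = *-cancelˡ-≡ (σ b) (c + b) M (begin
    M * σ b            ≡⟨ eq ⟩
    suc M * b          ≡⟨ cong (suc M *_) b≡cM ⟩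
    suc M * (c * M)    ≡⟨ solve 2 (λ M c → (con 1 :+ M) :* (c :* M) := M :* (c :+ c :* M)) refl M c ⟩
    M * (c + c * M)    ≡⟨ cong (λ t → M * (c + t)) (sym b≡cM) ⟩
    M * (c + b)        ∎)
    where open ≡-Reasoning
  c<b : c < b
  c<b = subst (c <_) (sym b≡cM) (m<m*n c M {{>-nonZero (m*n>0⇒m>0 (subst (0 <_) b≡cM b>0))}} M>1)
  c≡1 : c ≡ 1
  c≡1 with c ≟ 1
  ... | yes c≡1 = c≡1
  ... | no c≢1 = ⊥-elim (n≮n (c + b) (subst (1 + c + b ≤_) σb≡c+b
          (1+d+n≤σ b>0 (divides M (trans b≡cM (*-comm c M))) c≢1 (<⇒≢ c<b))))
  b≡M : b ≡ M
  b≡M = trans b≡cM (trans (cong (_* M) c≡1) (*-identityˡ M))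

even-perfect⇒euclid : Perfect m → 2 ∣ m →
  ∃ λ k → 1 ≤ k × Prime (2 ^ suc k ∸ 1) × m ≡ 2 ^ k * (2 ^ suc k ∸ 1)
even-perfect⇒euclid {m} perfect 2∣m with p-adic-split (s≤s (s≤s z≤n)) m (Perfect.positive perfect)
... | zero , b , m≡b , 2∤b = ⊥-elim (2∤b (subst (2 ∣_) (trans m≡b (*-identityˡ b)) 2∣m))
... | suc j , b , m≡2^k*b , 2∤b = k , s≤s z≤n , subst Prime (sym mersenne≡M) M-prime ,
  trans m≡2^k*b (cong (2 ^ k *_) (trans b≡M (sym mersenne≡M)))
  where
  k = suc j
  M = σ (2 ^ k)
  1+M≡2^[1+k] : 1 + M ≡ 2 ^ suc k
  1+M≡2^[1+k] = 1+σ[2^k]≡2^[1+k] k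
  mersenne≡M : 2 ^ suc k ∸ 1 ≡ M
  mersenne≡M = cong (_∸ 1) (sym 1+M≡2^[1+k])
  M>1 : 1 < M
  M>1 = s≤s⁻¹ (≤-trans (n≤1+n 3) (subst (4 ≤_) (sym 1+M≡2^[1+k]) (*-monoʳ-≤ 2 (*-monoʳ-≤ 2 (m^n>0 2 j)))))
  b>0 : 0 < b
  b>0 = m*n>0⇒n>0 (2 ^ k) (subst (0 <_) m≡2^k*b (Perfect.positive perfect))
  M*σb≡[1+M]*b : M * σ b ≡ suc M * b
  M*σb≡[1+M]*b = begin
    M * σ b           ≡⟨ sym (σ-multiplicative (m^n>0 2 k) b>0 (coprime-^ prime[2] 2∤b k)) ⟩
    σ (2 ^ k * b)     ≡⟨ cong σ (sym m≡2^k*b) ⟩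
    σ m               ≡⟨ Perfect.sigma≡2n perfect ⟩
    2 * m             ≡⟨ cong (2 *_) m≡2^k*b ⟩
    2 * (2 ^ k * b)   ≡⟨ sym (*-assoc 2 (2 ^ k) b) ⟩
    2 ^ suc k * b     ≡⟨ cong (_* b) (sym 1+M≡2^[1+k]) ⟩
    suc M * b         ∎
    where open ≡-Reasoning
  b≡M×σb≡1+b : b ≡ M × σ b ≡ 1 + b
  b≡M×σb≡1+b = M*σb≡[1+M]*b⇒b≡M M>1 b>0 M*σb≡[1+M]*b
  b≡M : b ≡ M
  b≡M = proj₁ b≡M×σb≡1+b
  M-prime : Prime M
  M-prime = subst Prime b≡M (σ≡1+n⇒prime (subst (1 <_) (sym b≡M) M>1) (proj₂ b≡M×σb≡1+b))

-- Odd perfect numbers of the form 5ᵉ A B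

square%8≢5 : ∀ w → (w * w) % 8 ≢ 5
square%8≢5 w = residue (w % 8) (m%n<n w 8) ∘ trans (sym (%-distribˡ-* w w 8))
  where
  residue : ∀ r → r < 8 → (r * r) % 8 ≢ 5
  residue 0 _ ()
  residue 1 _ ()
  residue 2 _ ()
  residue 3 _ ()
  residue 4 _ ()
  residue 5 _ ()
  residue 6 _ ()
  residue 7 _ ()
  residue (suc (suc (suc (suc (suc (suc (suc (suc _)))))))) (s≤s (s≤s (s≤s (s≤s (s≤s (s≤s (s≤s (s≤s ()))))))))

5*square%8≢1 : ∀ w → (5 * (w * w)) % 8 ≢ 1
5*square%8≢1 w = residue (w % 8) (m%n<n w 8) ∘ trans (sym reduce)
  where
  reduce : (5 * (w * w)) % 8 ≡ (5 * ((w % 8) * (w % 8) % 8)) % 8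
  reduce = trans (%-distribˡ-* 5 (w * w) 8) (cong (λ t → (5 * t) % 8) (%-distribˡ-* w w 8))
  residue : ∀ r → r < 8 → (5 * (r * r % 8)) % 8 ≢ 1
  residue 0 _ ()
  residue 1 _ ()
  residue 2 _ ()
  residue 3 _ ()
  residue 4 _ ()
  residue 5 _ ()
  residue 6 _ ()
  residue 7 _ ()
  residue (suc (suc (suc (suc (suc (suc (suc (suc _)))))))) (s≤s (s≤s (s≤s (s≤s (s≤s (s≤s (s≤s (s≤s ()))))))))

prime[5] : Prime 5
prime[5] = from-yes (prime? 5)

p^i*square≡square⊎p*square : ∀ p i s → ∃ λ u → p ^ i * (s * s) ≡ u * u ⊎ p ^ i * (s * s) ≡ p * (u * u)
p^i*square≡square⊎p*square p 0 s = s , inj₁ (+-identityʳ (s * s))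
p^i*square≡square⊎p*square p 1 s = s , inj₂ (cong (_* (s * s)) (*-identityʳ p))
p^i*square≡square⊎p*square p (suc (suc i)) s with u , square⊎p*square ← p^i*square≡square⊎p*square p i s =
  p * u , Sum.map (λ eq → trans (lift eq) (solve 2 (λ p u → p :* p :* (u :* u) := (p :* u) :* (p :* u)) refl p u))
                       (λ eq → trans (lift eq) (solve 2 (λ p u → p :* p :* (p :* (u :* u)) := p :* ((p :* u) :* (p :* u))) refl p u))
                       square⊎p*square
  where
  lift : ∀ {t} → p ^ i * (s * s) ≡ t → p ^ suc (suc i) * (s * s) ≡ p * p * t
  lift {t} eq = begin
    p * (p * p ^ i) * (s * s)   ≡⟨ solve 3 (λ p q r → p :* (p :* q) :* r := p :* p :* (q :* r)) refl p (p ^ i) (s * s) ⟩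
    p * p * (p ^ i * (s * s))   ≡⟨ cong (p * p *_) eq ⟩
    p * p * t                   ∎
    where open ≡-Reasoning

odd-perfect⇒square-factor : Prime p → Perfect n → ¬ 2 ∣ n → n ≡ p ^ e * (a * b) →
  ¬ p ∣ a * b → Coprime a b → (∃ λ s → s * s ≡ a) ⊎ (∃ λ s → s * s ≡ b)
odd-perfect⇒square-factor {p} {n} {e} {a} {b} p-prime perfect 2∤n n≡ p∤ab coprime
  = parity-cases (2 ∣? σ a) (2 ∣? σ b)
  where
  ab>0 : 0 < a * b
  ab>0 = m*n>0⇒n>0 (p ^ e) (subst (0 <_) n≡ (Perfect.positive perfect))
  a>0 : 0 < a
  a>0 = m*n>0⇒m>0 ab>0
  b>0 : 0 < b
  b>0 = m*n>0⇒n>0 a ab>0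
  ab∣n : a * b ∣ n
  ab∣n = divides (p ^ e) n≡
  a∣n : a ∣ n
  a∣n = ∣-trans (m∣m*n b) ab∣n
  b∣n : b ∣ n
  b∣n = ∣-trans (n∣m*n a) ab∣n
  σn≡ : σ n ≡ σ (p ^ e) * (σ a * σ b)
  σn≡ = begin
    σ n                     ≡⟨ cong σ n≡ ⟩
    σ (p ^ e * (a * b))     ≡⟨ σ-multiplicative (m^n>0 p {{prime⇒nonZero p-prime}} e) ab>0 (coprime-^ p-prime p∤ab e) ⟩
    σ (p ^ e) * σ (a * b)   ≡⟨ cong (σ (p ^ e) *_) (σ-multiplicative a>0 b>0 coprime) ⟩
    σ (p ^ e) * (σ a * σ b) ∎
    where open ≡-Reasoning
  parity-cases : Dec (2 ∣ σ a) → Dec (2 ∣ σ b) → (∃ λ s → s * s ≡ a) ⊎ (∃ λ s → s * s ≡ b)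
  parity-cases (no 2∤σa) _ = inj₁ (odd∧σ-odd⇒square a>0 (∣odd⇒odd a∣n 2∤n) 2∤σa)
  parity-cases (yes _) (no 2∤σb) = inj₂ (odd∧σ-odd⇒square b>0 (∣odd⇒odd b∣n 2∤n) 2∤σb)
  parity-cases (yes 2∣σa) (yes 2∣σb) = ⊥-elim (perfect∧odd⇒4∤σ perfect 2∤n
    (subst (4 ∣_) (sym σn≡) (∣n⇒∣m*n (σ (p ^ e)) (*-pres-∣ 2∣σa 2∣σb))))

-- Any common divisor of A and B divides 2B − A = 5, which is why only the prime 5 has to be split off.
odd-perfect-product⇒5*square : ∀ {A B} → Perfect n → ¬ 2 ∣ n → n ≡ A * B →
  A % 8 ≡ 5 → B % 8 ≡ 1 → 2 * B ≡ A + 5 → (∀ w → w * w ≢ B) → ∃ λ u → A ≡ 5 * (u * u)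
odd-perfect-product⇒5*square {n} {A} {B} perfect 2∤n n≡AB A%8≡5 B%8≡1 2B≡A+5 B-nonsquare =
  conclude (p-adic-split 5>1 A A>0) (p-adic-split 5>1 B B>0)
  where
  5>1 : 1 < 5
  5>1 = s≤s (s≤s z≤n)
  AB>0 : 0 < A * B
  AB>0 = subst (0 <_) n≡AB (Perfect.positive perfect)
  A>0 : 0 < A
  A>0 = m*n>0⇒m>0 AB>0
  B>0 : 0 < B
  B>0 = m*n>0⇒n>0 A AB>0

  coprime : ∀ {A′ B′} → A′ ∣ A → B′ ∣ B → ¬ 5 ∣ A′ → Coprime A′ B′
  coprime A′∣A B′∣B 5∤A′ {d} (d∣A′ , d∣B′) with prime⇒irreducible prime[5] d∣5
    where
    d∣5 : d ∣ 5
    d∣5 = ∣m+n∣m⇒∣n (subst (d ∣_) 2B≡A+5 (∣n⇒∣m*n 2 (∣-trans d∣B′ B′∣B))) (∣-trans d∣A′ A′∣A)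
  ... | inj₁ d≡1 = d≡1
  ... | inj₂ refl = ⊥-elim (5∤A′ d∣A′)

  n≡5^[i+j]*A′B′ : ∀ {i j A′ B′} → A ≡ 5 ^ i * A′ → B ≡ 5 ^ j * B′ → n ≡ 5 ^ (i + j) * (A′ * B′)
  n≡5^[i+j]*A′B′ {i} {j} {A′} {B′} A≡ B≡ = begin
    n                           ≡⟨ n≡AB ⟩
    A * B                       ≡⟨ cong₂ _*_ A≡ B≡ ⟩
    5 ^ i * A′ * (5 ^ j * B′)   ≡⟨ solve 4 (λ x y a b → x :* a :* (y :* b) := x :* y :* (a :* b)) refl (5 ^ i) (5 ^ j) A′ B′ ⟩
    5 ^ i * 5 ^ j * (A′ * B′)   ≡⟨ cong (_* (A′ * B′)) (sym (^-distribˡ-+-* 5 i j)) ⟩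
    5 ^ (i + j) * (A′ * B′)     ∎
    where open ≡-Reasoning

  conclude : (∃₂ λ i A′ → A ≡ 5 ^ i * A′ × ¬ 5 ∣ A′) → (∃₂ λ j B′ → B ≡ 5 ^ j * B′ × ¬ 5 ∣ B′) →
    ∃ λ u → A ≡ 5 * (u * u)
  conclude (i , A′ , A≡ , 5∤A′) (j , B′ , B≡ , 5∤B′)
    with odd-perfect⇒square-factor {e = i + j} prime[5] perfect 2∤n (n≡5^[i+j]*A′B′ {i} {j} A≡ B≡)
           ([ 5∤A′ , 5∤B′ ] ∘ euclidsLemma A′ B′ prime[5])
           (coprime (divides (5 ^ i) A≡) (divides (5 ^ j) B≡) 5∤A′)
  ... | inj₁ (s , refl) with p^i*square≡square⊎p*square 5 i s
  ...   | u , inj₁ A≡u² = ⊥-elim (square%8≢5 u (trans (cong (_% 8) (sym (trans A≡ A≡u²))) A%8≡5))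
  ...   | u , inj₂ A≡5u² = u , trans A≡ A≡5u²
  conclude (i , A′ , A≡ , 5∤A′) (j , B′ , B≡ , 5∤B′) | inj₂ (s , refl) with p^i*square≡square⊎p*square 5 j s
  ...   | u , inj₁ B≡u² = ⊥-elim (B-nonsquare u (sym (trans B≡ B≡u²)))
  ...   | u , inj₂ B≡5u² = ⊥-elim (5*square%8≢1 u (trans (cong (_% 8) (sym (trans B≡ B≡5u²))) B%8≡1))

-- Perfect numbers three apart

even⊎odd : ∀ n → ∃ λ t → n ≡ t + t ⊎ n ≡ suc (t + t)
even⊎odd zero = 0 , inj₁ refl
even⊎odd (suc n) with even⊎odd n
... | t , inj₁ refl = t , inj₂ refl
... | t , inj₂ refl = suc t , inj₁ (cong suc (sym (+-suc t t)))

4^i≡1+3q : ∀ i → ∃ λ q → 4 ^ i ≡ 1 + 3 * q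
4^i≡1+3q zero = 0 , refl
4^i≡1+3q (suc i) with q , 4^i≡ ← 4^i≡1+3q i =
  1 + 4 * q , trans (cong (4 *_) 4^i≡) (solve 1 (λ q → con 4 :* (con 1 :+ con 3 :* q) := con 1 :+ con 3 :* (con 1 :+ con 4 :* q)) refl q)

square≢square+1 : 0 < s → w * w ≢ s * s + 1
square≢square+1 {s} {w} s>0 w²≡s²+1 with w ≤? s
... | yes w≤s = <⇒≱ (subst (s * s <_) (sym w²≡s²+1) (m<m+n (s * s) z<s)) (*-mono-≤ w≤s w≤s)
... | no w≰s = <⇒≱ s²+1<[1+s]² (subst ((suc s) * (suc s) ≤_) w²≡s²+1 (*-mono-≤ (≰⇒> w≰s) (≰⇒> w≰s)))
  where
  s²+1<[1+s]² : s * s + 1 < suc s * suc s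
  s²+1<[1+s]² = subst (s * s + 1 <_) (solve 1 (λ s → s :* s :+ con 1 :+ (s :+ s) := (con 1 :+ s) :* (con 1 :+ s)) refl s)
    (m<m+n (s * s + 1) (<-≤-trans s>0 (m≤m+n s s)))

2∤3 : ¬ 2 ∣ 3
2∤3 2∣3 = 2∤1 (∣m+n∣m⇒∣n 2∣3 (divides 1 refl))

-- With P = 8(h + 1): n = P(2P − 1) − 3 = (16h + 13)(8h + 9).
P[2P∸1]≡perfect+3⇒2P≡5u²+3 : Perfect n → P ≡ s * s → 0 < s → P ≡ 8 * suc h →
  P * (2 * P ∸ 1) ≡ n + 3 → ∃ λ u → 2 * P ≡ 5 * (u * u) + 3
P[2P∸1]≡perfect+3⇒2P≡5u²+3 {n} {P} {s} {h} perfect P≡s² s>0 refl P[2P∸1]≡n+3 =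
  let u , A≡5u² = odd-perfect-product⇒5*square perfect 2∤n n≡AB A%8≡5 B%8≡1 2B≡A+5 B-nonsquare
  in u , trans 2P≡A+3 (cong (_+ 3) A≡5u²)
  where
  A = 16 * h + 13
  B = 8 * h + 9
  2P∸1≡ : 2 * P ∸ 1 ≡ 16 * h + 15
  2P∸1≡ = cong (_∸ 1) (solve 1 (λ h → con 2 :* (con 8 :* (con 1 :+ h)) := con 1 :+ (con 16 :* h :+ con 15)) refl h)
  n≡AB : n ≡ A * B
  n≡AB = +-cancelʳ-≡ 3 n (A * B) (begin
    n + 3                          ≡⟨ sym P[2P∸1]≡n+3 ⟩
    P * (2 * P ∸ 1)                ≡⟨ cong (P *_) 2P∸1≡ ⟩
    8 * suc h * (16 * h + 15)      ≡⟨ solve 1 (λ h → con 8 :* (con 1 :+ h) :* (con 16 :* h :+ con 15) := (con 16 :* h :+ con 13) :* (con 8 :* h :+ con 9) :+ con 3) refl h ⟩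
    A * B + 3                      ∎)
    where open ≡-Reasoning
  2∤n : ¬ 2 ∣ n
  2∤n 2∣n = 2∤3 (∣m+n∣m⇒∣n (subst (2 ∣_) P[2P∸1]≡n+3 (∣-trans 2∣P (m∣m*n (2 * P ∸ 1)))) 2∣n)
    where
    2∣P : 2 ∣ 8 * suc h
    2∣P = ∣-trans (divides 4 refl) (m∣m*n (suc h))
  A%8≡5 : A % 8 ≡ 5
  A%8≡5 = %-remove-+ˡ 13 (divides (2 * h) (solve 1 (λ h → con 16 :* h := con 2 :* h :* con 8) refl h))
  B%8≡1 : B % 8 ≡ 1
  B%8≡1 = %-remove-+ˡ 9 (divides h (*-comm 8 h))
  2B≡A+5 : 2 * B ≡ A + 5
  2B≡A+5 = solve 1 (λ h → con 2 :* (con 8 :* h :+ con 9) := con 16 :* h :+ con 13 :+ con 5) refl h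
  B-nonsquare : ∀ w → w * w ≢ B
  B-nonsquare w w²≡B = square≢square+1 {w = w} s>0 (trans w²≡B (trans B≡P+1 (cong (_+ 1) P≡s²)))
    where
    B≡P+1 : B ≡ 8 * suc h + 1
    B≡P+1 = solve 1 (λ h → con 8 :* h :+ con 9 := con 8 :* (con 1 :+ h) :+ con 1) refl h
  2P≡A+3 : 2 * (8 * suc h) ≡ A + 3
  2P≡A+3 = solve 1 (λ h → con 2 :* (con 8 :* (con 1 :+ h)) := con 16 :* h :+ con 13 :+ con 3) refl h

¬prime[4^[2+t]∸1] : ∀ t → ¬ Prime (4 ^ suc (suc t) ∸ 1)
¬prime[4^[2+t]∸1] t M-prime with q , 4^[2+t]≡1+3q ← 4^i≡1+3q (suc (suc t))
  with prime⇒irreducible M-prime (divides q (trans (cong (_∸ 1) 4^[2+t]≡1+3q) (*-comm 3 q)))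
... | inj₁ ()
... | inj₂ 3≡M = ≤⇒≯ (subst (16 ≤_) 4^[2+t]≡4 (*-monoʳ-≤ 4 (*-monoʳ-≤ 4 (m^n>0 4 t)))) (s≤s (s≤s (s≤s (s≤s (s≤s z≤n)))))
  where
  q≡1 : q ≡ 1
  q≡1 = sym (*-cancelˡ-≡ 1 q 3 (trans 3≡M (cong (_∸ 1) 4^[2+t]≡1+3q)))
  4^[2+t]≡4 : 4 ^ suc (suc t) ≡ 4
  4^[2+t]≡4 = trans 4^[2+t]≡1+3q (cong (λ r → 1 + 3 * r) q≡1)

2^[2+2u]≡4^[1+u] : ∀ u → 2 ^ suc (suc (u + u)) ≡ 4 ^ suc u
2^[2+2u]≡4^[1+u] u = trans (cong (2 ^_) (solve 1 (λ u → con 2 :+ (u :+ u) := con 2 :* (con 1 :+ u)) refl u)) (sym (^-*-assoc 2 2 (suc u)))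

σ3≢6 : σ 3 ≢ 2 * 3
σ3≢6 ()

σ9≢18 : σ 9 ≢ 2 * 9
σ9≢18 ()

odd-perfect≢perfect+3 : Perfect m → Perfect n → ¬ 2 ∣ m → m ≢ n + 3
odd-perfect≢perfect+3 {m} {n} m-perfect n-perfect 2∤m m≡n+3 with 2 ∣? n
... | no 2∤n = 2∤m (subst (2 ∣_) (sym m≡n+3) (odd+odd⇒even 2∤n 2∤3))
... | yes 2∣n with even-perfect⇒euclid n-perfect 2∣n
...   | 1 , _ , _ , n≡6 =
  σ9≢18 (subst (λ x → σ x ≡ 2 * x) (trans m≡n+3 (cong (_+ 3) n≡6)) (Perfect.sigma≡2n m-perfect))
...   | suc (suc k) , _ , _ , n≡ =
  perfect∧odd⇒4∤σ m-perfect 2∤m (4∣x+1⇒4∣σ (Perfect.positive m-perfect) 4∣m+1)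
  where
  4∣n : 4 ∣ n
  4∣n = divides (2 ^ k * (2 ^ suc (suc (suc k)) ∸ 1)) (trans n≡ (solve 2 (λ a b → con 2 :* (con 2 :* a) :* b := a :* b :* con 4) refl (2 ^ k) _))
  4∣m+1 : 4 ∣ m + 1
  4∣m+1 = subst (4 ∣_) (trans (sym (+-assoc n 3 1)) (cong (_+ 1) (sym m≡n+3))) (∣m∣n⇒∣m+n 4∣n ∣-refl)

2^k[2^[1+k]∸1]≡perfect+3⇒2^[1+k]≡5u²+3 : ∀ {k} → Perfect n → 1 ≤ k → Prime (2 ^ suc k ∸ 1) →
  2 ^ k * (2 ^ suc k ∸ 1) ≡ n + 3 → ∃ λ u → 2 ^ suc k ≡ 5 * (u * u) + 3
2^k[2^[1+k]∸1]≡perfect+3⇒2^[1+k]≡5u²+3 {n} {k} n-perfect 1≤k M-prime P[2P∸1]≡n+3 with even⊎odd k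
... | 0 , inj₁ refl = ⊥-elim (n≮0 1≤k)
... | 0 , inj₂ refl = ⊥-elim (σ3≢6 (subst (λ x → σ x ≡ 2 * x) n≡3 (Perfect.sigma≡2n n-perfect)))
  where
  n≡3 : n ≡ 3
  n≡3 = +-cancelʳ-≡ 3 n 3 (sym P[2P∸1]≡n+3)
... | 1 , inj₁ refl = 1 , refl
... | suc t , inj₂ refl = ⊥-elim (¬prime[4^[2+t]∸1] t (subst (λ x → Prime (x ∸ 1)) (2^[2+2u]≡4^[1+u] (suc t)) M-prime))
... | suc (suc t) , inj₁ refl =
  P[2P∸1]≡perfect+3⇒2P≡5u²+3 n-perfect (^-distribˡ-+-* 2 (suc (suc t)) (suc (suc t))) (m^n>0 2 (suc (suc t))) P≡8*[1+h] P[2P∸1]≡n+3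
  where
  q = 2 ^ t
  instance
    q≢0 : NonZero q
    q≢0 = m^n≢0 2 t
    q²≢0 : NonZero (q * q)
    q²≢0 = m*n≢0 q q
    2q²≢0 : NonZero (2 * (q * q))
    2q²≢0 = m*n≢0 2 (q * q)
  P≡8*[1+h] : 2 ^ (suc (suc t) + suc (suc t)) ≡ 8 * suc (pred (2 * (q * q)))
  P≡8*[1+h] = begin
    2 ^ (suc (suc t) + suc (suc t))  ≡⟨ ^-distribˡ-+-* 2 (suc (suc t)) (suc (suc t)) ⟩
    2 * (2 * q) * (2 * (2 * q))      ≡⟨ solve 1 (λ q → con 2 :* (con 2 :* q) :* (con 2 :* (con 2 :* q)) := con 8 :* (con 2 :* (q :* q))) refl q ⟩
    8 * (2 * (q * q))                ≡⟨ cong (8 *_) (sym (suc-pred (2 * (q * q)))) ⟩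
    8 * suc (pred (2 * (q * q)))     ∎
    where open ≡-Reasoning

-- Opened only here: the constructor +_ would make sections such as (x +_) ambiguous above.
open import Data.Integer as ℤ using (ℤ; +_)
import Data.Integer.Properties as ℤ

lemma1p6 : (m n : ℕ) → Perfect m → Perfect n → m ≡ n + 3 →
    Σ ℕ (λ p → Prime (2 ^ p ∸ 1) × (m ≡ 2 ^ (p ∸ 1) * (2 ^ p ∸ 1))
      × Σ ℤ (λ u → + (2 ^ p) ≡ (+ 5) ℤ.* (u ℤ.* u) ℤ.+ (+ 3)))
lemma1p6 m n m-perfect n-perfect m≡n+3 with 2 ∣? m
... | no 2∤m = ⊥-elim (odd-perfect≢perfect+3 m-perfect n-perfect 2∤m m≡n+3)
... | yes 2∣m with k , 1≤k , M-prime , m≡ ← even-perfect⇒euclid m-perfect 2∣m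
  with u , 2^[1+k]≡5u²+3 ← 2^k[2^[1+k]∸1]≡perfect+3⇒2^[1+k]≡5u²+3 n-perfect 1≤k M-prime (trans (sym m≡) m≡n+3) =
  suc k , M-prime , m≡ , + u , trans (cong +_ 2^[1+k]≡5u²+3) ℕ→ℤ
  where
  ℕ→ℤ : + (5 * (u * u) + 3) ≡ + 5 ℤ.* (+ u ℤ.* + u) ℤ.+ + 3
  ℕ→ℤ = trans (ℤ.pos-+ (5 * (u * u)) 3) (cong (ℤ._+ + 3) (trans (ℤ.pos-* 5 (u * u)) (cong (+ 5 ℤ.*_) (ℤ.pos-* u u))))
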